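{- Let $p$ be a prime, $k \geq 1$, $n \geq 0$, $d \in \{0, 1, \dots, p - 1\}$, and $0 \leq i \leq k - 1$. Let $\mathbf{m} = (m_1,\dots,m_k) \in \mathbb{N}^k$ with $m_1 + \cdots + m_k = p n + d - i$. Let $j = n - \sum_{t=1}^k \lfloor m_t/p \rfloor$. Then $\sum_{t=1}^k (m_t \bmod p) = p j + d - i$, $0 \leq j \leq k - 1$, and \[ \nu_p\!\left(\frac{(p n + d)!}{(p n + d - i)!}\right) + \nu_p\!\left(\frac{(m_1+\cdots+m_k)!}{m_1!\cdots m_k!}\right) = \nu_p\!\left(\frac{n!}{(n - j)!}\right) + \nu_p\!\left(\frac{(c_1+\cdots+c_k)!}{c_1!\cdots c_k!}\right) + j, \] where $c_t = \lfloor m_t/p \rfloor$ for $1 \le t \le k$.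
   Context: $\mathbb{N}$ denotes the set of non-negative integers. $\nu_p(N)$ denotes the $p$-adic valuation of a positive integer $N$ (exponent of the highest power of $p$ dividing $N$). $m \bmod p$ denotes the least non-negative residue of $m$ modulo $p$. -}

module Defs where

open import Data.Nat using (ℕ; zero; suc; _+_; _*_; _∸_; _^_; _!; NonZero)
open import Data.Nat.Properties using (_!≢0; m*n≢0)
open import Data.Nat.Divisibility using (_∣_)
open import Data.Nat.DivMod using (_/_)
open import Data.Vec using (Vec; []; _∷_; sum; map)
open import Data.Product using (_×_)
open import Relation.Nullary using (¬_)

IsValuation : ℕ → ℕ → ℕ → Set
IsValuation p N v = (p ^ v ∣ N) × ¬ (p ^ suc v ∣ N)

prodFact : ∀ {k} → Vec ℕ k → ℕ
prodFact []       = 1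
prodFact (x ∷ xs) = x ! * prodFact xs

prodFact≢0 : ∀ {k} (xs : Vec ℕ k) → NonZero (prodFact xs)
prodFact≢0 []       = _
prodFact≢0 (x ∷ xs) = m*n≢0 (x !) (prodFact xs) {{x !≢0}} {{prodFact≢0 xs}}

multinomial : ∀ {k} → Vec ℕ k → ℕ
multinomial ms = (sum ms ! / prodFact ms) {{prodFact≢0 ms}}

factRatio : ℕ → ℕ → ℕ
factRatio a b = (a ! / b !) {{b !≢0}}

{-# OPTIONS --safe #-}
module Submission where

open import Defs
open import Data.Nat using (ℕ; zero; suc; _+_; _*_; _∸_; _^_; _!; _≤_; _<_; NonZero; z≤n; pred; ≢-nonZero; ≢-nonZero⁻¹; nonTrivial⇒n>1)
open import Data.Nat.Properties
open import Data.Nat.DivMod using (_/_; _%_; m≡m%n+[m/n]*n; m%n<n; m/n*n≡m)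
open import Data.Nat.Divisibility
open import Data.Nat.Primality using (Prime; euclidsLemma; prime⇒nonTrivial)
open import Data.Nat.Combinatorics using (k![n∸k]!∣n!)
open import Data.Nat.Induction using (<-rec)
open import Data.Nat.Solver using (module +-*-Solver)
open import Data.Vec using (Vec; sum; map; []; _∷_)
open import Data.Product using (_×_; _,_; ∃; proj₁; proj₂)
open import Data.Sum using (inj₁; inj₂)
open import Data.Empty using (⊥-elim)
open import Relation.Nullary using (¬_; yes; no)
open import Relation.Binary.Definitions using (tri<; tri≈; tri>)
open import Relation.Binary.PropositionalEquality
open +-*-Solver using (solve; _:+_; _:*_; _:=_; con)

-- Among 1, …, pq + r the multiples of p are p·1, …, p·q, so for r < p we have (pq + r)! = p^q · q! · u with
-- p ∤ u, that is ν_p((pq + r)!) = q + ν_p(q!). Applied to pn + d and to each m_t = p c_t + (m_t mod p) this gives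
-- ν_p((pn + d)!) = n + ν_p(n!) and ν_p(∏ m_t!) = Σ c_t + ν_p(∏ c_t!); writing every ratio of factorials as a
-- difference of valuations, the identity reduces to n = j + Σ c_t. The digit claims come from
-- Σ m_t = Σ (m_t mod p) + p Σ c_t: d < p forces Σ c_t ≤ n, and Σ (m_t mod p) ≤ k(p − 1) forces j < k.

^-monoʳ-∣ : ∀ m {a b} → a ≤ b → m ^ a ∣ m ^ b
^-monoʳ-∣ m {a} {b} a≤b = divides (m ^ (b ∸ a)) (begin
  m ^ b                 ≡⟨ cong (m ^_) (m+[n∸m]≡n a≤b) ⟨
  m ^ (a + (b ∸ a))     ≡⟨ ^-distribˡ-+-* m a (b ∸ a) ⟩
  m ^ a * m ^ (b ∸ a)   ≡⟨ *-comm (m ^ a) (m ^ (b ∸ a)) ⟩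
  m ^ (b ∸ a) * m ^ a   ∎)
  where open ≡-Reasoning

prodFact∣sum! : ∀ {k} (ms : Vec ℕ k) → prodFact ms ∣ sum ms !
prodFact∣sum! []       = ∣-refl
prodFact∣sum! (x ∷ xs) = ∣-trans (*-monoʳ-∣ (x !) (prodFact∣sum! xs))
  (subst (λ z → x ! * z ! ∣ (x + sum xs) !) (m+n∸m≡n x (sum xs)) (k![n∸k]!∣n! (m≤m+n x (sum xs))))

isValuation-unique : ∀ {p N a b} → IsValuation p N a → IsValuation p N b → a ≡ b
isValuation-unique {p} {N} {a} {b} (pᵃ∣N , pᵃ⁺¹∤N) (pᵇ∣N , pᵇ⁺¹∤N) with <-cmp a b
... | tri< a<b _ _ = ⊥-elim (pᵃ⁺¹∤N (∣-trans (^-monoʳ-∣ p a<b) pᵇ∣N))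
... | tri≈ _ a≡b _ = a≡b
... | tri> _ _ b<a = ⊥-elim (pᵇ⁺¹∤N (∣-trans (^-monoʳ-∣ p b<a) pᵃ∣N))

isValuation-0 : ∀ {p u} → ¬ p ∣ u → IsValuation p u 0
isValuation-0 {p} {u} p∤u = 1∣ u , λ p*1∣u → p∤u (subst (_∣ u) (*-identityʳ p) p*1∣u)

module Digits (p : ℕ) .{{_ : NonZero p}} where

  sum≡sum[%p]+p*sum[/p] : ∀ {k} (m : Vec ℕ k) → sum m ≡ sum (map (_% p) m) + p * sum (map (_/ p) m)
  sum≡sum[%p]+p*sum[/p] []       = sym (*-zeroʳ p)
  sum≡sum[%p]+p*sum[/p] (x ∷ xs) = begin
    x + sum xs                          ≡⟨ cong₂ _+_ (m≡m%n+[m/n]*n x p) (sum≡sum[%p]+p*sum[/p] xs) ⟩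
    (x % p + x / p * p) + (R + p * C)   ≡⟨ solve 5 (λ r c p R C → (r :+ c :* p) :+ (R :+ p :* C) := (r :+ R) :+ p :* (c :+ C)) refl (x % p) (x / p) p R C ⟩
    (x % p + R) + p * (x / p + C)       ∎
    where
    open ≡-Reasoning
    R = sum (map (_% p) xs)
    C = sum (map (_/ p) xs)

  sum[%p]+k≤k*p : ∀ {k} (m : Vec ℕ k) → sum (map (_% p) m) + k ≤ k * p
  sum[%p]+k≤k*p []               = z≤n
  sum[%p]+k≤k*p {suc k} (x ∷ xs) = begin
    (x % p + R) + suc k   ≡⟨ solve 3 (λ r R k → (r :+ R) :+ (con 1 :+ k) := (con 1 :+ r) :+ (R :+ k)) refl (x % p) R k ⟩
    suc (x % p) + (R + k) ≤⟨ +-mono-≤ (m%n<n x p) (sum[%p]+k≤k*p xs) ⟩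
    p + k * p             ∎
    where
    open ≤-Reasoning
    R = sum (map (_% p) xs)

  p*m≤p*n+d⇒m≤n : ∀ {m n d} → d < p → p * m ≤ p * n + d → m ≤ n
  p*m≤p*n+d⇒m≤n {m} {n} {d} d<p p*m≤p*n+d = m<1+n⇒m≤n (*-cancelˡ-< p m (suc n) (begin-strict
    p * m      ≤⟨ p*m≤p*n+d ⟩
    p * n + d  <⟨ +-monoʳ-< (p * n) d<p ⟩
    p * n + p  ≡⟨ trans (+-comm (p * n) p) (sym (*-suc p n)) ⟩
    p * suc n  ∎))
    where open ≤-Reasoning

  R+p*C+i≡p*n+d⇒R+i≡p*[n∸C]+d : ∀ {R C i n d} → C ≤ n → R + p * C + i ≡ p * n + d → R + i ≡ p * (n ∸ C) + d
  R+p*C+i≡p*n+d⇒R+i≡p*[n∸C]+d {R} {C} {i} {n} {d} C≤n eq = +-cancelʳ-≡ (p * C) (R + i) (p * (n ∸ C) + d) (begin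
    (R + i) + p * C            ≡⟨ solve 3 (λ R i P → (R :+ i) :+ P := R :+ P :+ i) refl R i (p * C) ⟩
    R + p * C + i              ≡⟨ eq ⟩
    p * n + d                  ≡⟨ cong (λ z → p * z + d) (m∸n+n≡m C≤n) ⟨
    p * (n ∸ C + C) + d        ≡⟨ solve 4 (λ p j C d → p :* (j :+ C) :+ d := (p :* j :+ d) :+ p :* C) refl p (n ∸ C) C d ⟩
    (p * (n ∸ C) + d) + p * C  ∎)
    where open ≡-Reasoning

module Valuation {p : ℕ} (pr : Prime p) .{{_ : NonZero p}} where

  private
    1<p : 1 < p
    1<p = nonTrivial⇒n>1 p {{prime⇒nonTrivial pr}}

  ¬p∣1 : ¬ p ∣ 1
  ¬p∣1 p∣1 = <-irrefl (sym (∣1⇒≡1 p∣1)) 1<p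

  isValuation-^ : ∀ q → IsValuation p (p ^ q) q
  isValuation-^ q = ∣-refl , λ p*pᵠ∣pᵠ → <⇒≱ pᵠ<p*pᵠ (∣⇒≤ {{m^n≢0 p q}} p*pᵠ∣pᵠ)
    where
    pᵠ<p*pᵠ : p ^ q < p * p ^ q
    pᵠ<p*pᵠ = subst (_< p * p ^ q) (*-identityˡ (p ^ q)) (*-monoˡ-< (p ^ q) {{m^n≢0 p q}} 1<p)

  isValuation-* : ∀ {x y a b} → IsValuation p x a → IsValuation p y b → IsValuation p (x * y) (a + b)
  isValuation-* {x} {y} {a} {b} (divides u x≡u*pᵃ , pᵃ⁺¹∤x) (divides v y≡v*pᵇ , pᵇ⁺¹∤y) =
    subst (p ^ (a + b) ∣_) (sym xy≡uv*pᵃ⁺ᵇ) (n∣m*n (u * v)) , pᵃ⁺ᵇ⁺¹∤xy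
    where
    p∤u : ¬ p ∣ u
    p∤u p∣u = pᵃ⁺¹∤x (subst (p * p ^ a ∣_) (sym x≡u*pᵃ) (*-monoˡ-∣ (p ^ a) p∣u))
    p∤v : ¬ p ∣ v
    p∤v p∣v = pᵇ⁺¹∤y (subst (p * p ^ b ∣_) (sym y≡v*pᵇ) (*-monoˡ-∣ (p ^ b) p∣v))
    xy≡uv*pᵃ⁺ᵇ : x * y ≡ (u * v) * p ^ (a + b)
    xy≡uv*pᵃ⁺ᵇ = begin
      x * y                        ≡⟨ cong₂ _*_ x≡u*pᵃ y≡v*pᵇ ⟩
      (u * p ^ a) * (v * p ^ b)    ≡⟨ solve 4 (λ u v A B → (u :* A) :* (v :* B) := (u :* v) :* (A :* B)) refl u v (p ^ a) (p ^ b) ⟩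
      (u * v) * (p ^ a * p ^ b)    ≡⟨ cong ((u * v) *_) (^-distribˡ-+-* p a b) ⟨
      (u * v) * p ^ (a + b)        ∎
      where open ≡-Reasoning
    pᵃ⁺ᵇ⁺¹∤xy : ¬ p * p ^ (a + b) ∣ x * y
    pᵃ⁺ᵇ⁺¹∤xy p*pᵃ⁺ᵇ∣xy with euclidsLemma u v pr
      (*-cancelʳ-∣ (p ^ (a + b)) {{m^n≢0 p (a + b)}} (subst (p * p ^ (a + b) ∣_) xy≡uv*pᵃ⁺ᵇ p*pᵃ⁺ᵇ∣xy))
    ... | inj₁ p∣u = p∤u p∣u
    ... | inj₂ p∣v = p∤v p∣v

  isValuation-exists : ∀ N → .{{NonZero N}} → ∃ (IsValuation p N)
  isValuation-exists = <-rec (λ N → .{{NonZero N}} → ∃ (IsValuation p N)) step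
    where
    step : ∀ N → (∀ {M} → M < N → .{{NonZero M}} → ∃ (IsValuation p M)) → .{{NonZero N}} → ∃ (IsValuation p N)
    step N rec with p ∣? N
    ... | no p∤N = 0 , isValuation-0 p∤N
    ... | yes (divides q N≡q*p) = suc v , subst₂ (IsValuation p) q*p¹≡N (+-comm v 1) (isValuation-* {q} {p ^ 1} {v} νq (isValuation-^ 1))
      where
      q≢0 : NonZero q
      q≢0 = ≢-nonZero λ q≡0 → ≢-nonZero⁻¹ N (trans N≡q*p (cong (_* p) q≡0))
      q<N : q < N
      q<N = subst (q <_) (sym N≡q*p) (m<m*n q p {{q≢0}} 1<p)
      v = proj₁ (rec q<N {{q≢0}})
      νq = proj₂ (rec q<N {{q≢0}})
      q*p¹≡N : q * p ^ 1 ≡ N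
      q*p¹≡N = trans (cong (q *_) (*-identityʳ p)) (sym N≡q*p)

  isValuation-/ : ∀ {N d a w u} .{{_ : NonZero d}} → d ∣ N →
                  IsValuation p (N / d) a → IsValuation p d w → IsValuation p N u → a + w ≡ u
  isValuation-/ {N} {d} {a} {w} d∣N νN/d νd νN =
    isValuation-unique (subst (λ z → IsValuation p z (a + w)) (m/n*n≡m d∣N) (isValuation-* {N / d} {d} {a} νN/d νd)) νN

  isValuation-factRatio : ∀ A B {a w u} → B ≤ A →
    IsValuation p (factRatio A B) a → IsValuation p (B !) w → IsValuation p (A !) u → a + w ≡ u
  isValuation-factRatio A B {a} {w} B≤A = isValuation-/ {a = a} {w} {{B !≢0}} (m≤n⇒m!∣n! B≤A)

  isValuation-multinomial : ∀ {k} (ms : Vec ℕ k) {b w u} →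
    IsValuation p (multinomial ms) b → IsValuation p (prodFact ms) w → IsValuation p (sum ms !) u → b + w ≡ u
  isValuation-multinomial ms {b} {w} = isValuation-/ {a = b} {w} {{prodFact≢0 ms}} (prodFact∣sum! ms)

  p∤p*q+suc[r] : ∀ q r → suc r < p → ¬ p ∣ p * q + suc r
  p∤p*q+suc[r] q r 1+r<p p∣p*q+1+r = <⇒≱ 1+r<p (∣⇒≤ (∣m+n∣m⇒∣n p∣p*q+1+r (m∣m*n q)))

  [p*q+r]!≡p^q*q!*unit : ∀ q r → r < p → ∃ λ u → ¬ p ∣ u × (p * q + r) ! ≡ p ^ q * (q ! * u)
  [p*q+r]!≡p^q*q!*unit zero zero _ rewrite *-zeroʳ p = 1 , ¬p∣1 , refl
  [p*q+r]!≡p^q*q!*unit (suc q) zero _ with [p*q+r]!≡p^q*q!*unit q (pred p) pred[p]<p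
    where
    pred[p]<p : pred p < p
    pred[p]<p = subst (pred p <_) (suc-pred p) (n<1+n (pred p))
  ... | u , p∤u , eq = u , p∤u , (begin
    (p * suc q + 0) !                           ≡⟨ cong _! p*[1+q]+0≡1+[p*q+pred[p]] ⟩
    suc (p * q + pred p) * (p * q + pred p) !   ≡⟨ cong₂ _*_ (sym p*[1+q]+0≡1+[p*q+pred[p]]) eq ⟩
    (p * suc q + 0) * (p ^ q * (q ! * u))       ≡⟨ solve 5 (λ p q P F u → (p :* (con 1 :+ q) :+ con 0) :* (P :* (F :* u)) := (p :* P) :* ((con 1 :+ q) :* F :* u)) refl p q (p ^ q) (q !) u ⟩
    (p * p ^ q) * ((suc q * q !) * u)           ∎)
    where
    open ≡-Reasoning
    p*[1+q]+0≡1+[p*q+pred[p]] : p * suc q + 0 ≡ suc (p * q + pred p)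
    p*[1+q]+0≡1+[p*q+pred[p]] = begin
      p * suc q + 0           ≡⟨ trans (+-identityʳ _) (*-suc p q) ⟩
      p + p * q               ≡⟨ cong (_+ p * q) (suc-pred p) ⟨
      suc (pred p + p * q)    ≡⟨ cong suc (+-comm (pred p) (p * q)) ⟩
      suc (p * q + pred p)    ∎
  [p*q+r]!≡p^q*q!*unit q (suc r) 1+r<p with [p*q+r]!≡p^q*q!*unit q r (<-trans (n<1+n r) 1+r<p)
  ... | u , p∤u , eq = suc (p * q + r) * u , p∤[1+p*q+r]*u , (begin
    (p * q + suc r) !                       ≡⟨ cong _! (+-suc (p * q) r) ⟩
    suc (p * q + r) * (p * q + r) !         ≡⟨ cong (suc (p * q + r) *_) eq ⟩
    suc (p * q + r) * (p ^ q * (q ! * u))   ≡⟨ solve 4 (λ X P F u → X :* (P :* (F :* u)) := P :* (F :* (X :* u))) refl (suc (p * q + r)) (p ^ q) (q !) u ⟩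
    p ^ q * (q ! * (suc (p * q + r) * u))   ∎)
    where
    open ≡-Reasoning
    p∤[1+p*q+r]*u : ¬ p ∣ suc (p * q + r) * u
    p∤[1+p*q+r]*u p∣ with euclidsLemma (suc (p * q + r)) u pr p∣
    ... | inj₁ p∣1+p*q+r = p∤p*q+suc[r] q r 1+r<p (subst (p ∣_) (sym (+-suc (p * q) r)) p∣1+p*q+r)
    ... | inj₂ p∣u       = p∤u p∣u

  isValuation-[p*q+r]! : ∀ q r → r < p → ∀ {w} → IsValuation p (q !) w → IsValuation p ((p * q + r) !) (q + w)
  isValuation-[p*q+r]! q r r<p {w} νq! with [p*q+r]!≡p^q*q!*unit q r r<p
  ... | u , p∤u , eq = subst₂ (IsValuation p) (sym eq) (cong (q +_) (+-identityʳ w))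
    (isValuation-* {p ^ q} {q ! * u} {q} (isValuation-^ q) (isValuation-* {q !} {u} {w} νq! (isValuation-0 p∤u)))

  isValuation-prodFact : ∀ {k} (m : Vec ℕ k) →
    ∃ λ w → IsValuation p (prodFact (map (_/ p) m)) w × IsValuation p (prodFact m) (sum (map (_/ p) m) + w)
  isValuation-prodFact [] = 0 , isValuation-0 ¬p∣1 , isValuation-0 ¬p∣1
  isValuation-prodFact (x ∷ xs) with isValuation-prodFact xs | isValuation-exists ((x / p) !) {{(x / p) !≢0}}
  ... | w , νc , νm | w₀ , νx/p! =
    w₀ + w , isValuation-* {(x / p) !} {prodFact (map (_/ p) xs)} {w₀} νx/p! νc ,
    subst (IsValuation p (x ! * prodFact xs)) (solve 4 (λ c C w₀ w → (c :+ w₀) :+ (C :+ w) := (c :+ C) :+ (w₀ :+ w)) refl (x / p) (sum (map (_/ p) xs)) w₀ w)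
      (isValuation-* {x !} {prodFact xs} {x / p + w₀} νx! νm)
    where
    p*[x/p]+x%p≡x : p * (x / p) + x % p ≡ x
    p*[x/p]+x%p≡x = trans (+-comm _ (x % p)) (trans (cong (x % p +_) (*-comm p (x / p))) (sym (m≡m%n+[m/n]*n x p)))
    νx! : IsValuation p (x !) (x / p + w₀)
    νx! = subst (λ z → IsValuation p (z !) (x / p + w₀)) p*[x/p]+x%p≡x (isValuation-[p*q+r]! (x / p) (x % p) (m%n<n x p) νx/p!)

  valuation-balance : ∀ {k} n d i (m : Vec ℕ k) → d < p → sum m + i ≡ p * n + d →
    let c = map (_/ p) m
        j = n ∸ sum c
    in sum c ≤ n → (a b e f : ℕ) →
       IsValuation p (factRatio (p * n + d) (p * n + d ∸ i)) a →
       IsValuation p (multinomial m) b →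
       IsValuation p (factRatio n (n ∸ j)) e →
       IsValuation p (multinomial c) f →
       a + b ≡ e + f + j
  valuation-balance n d i m d<p sum+i≡p*n+d C≤n a b e f νa νb νe νf =
    +-cancelʳ-≡ (C + Pc) (a + b) (e + f + j) (begin
      (a + b) + (C + Pc)         ≡⟨ +-assoc a b (C + Pc) ⟩
      a + (b + (C + Pc))         ≡⟨ cong (a +_) b+[C+Pc]≡Vm ⟩
      a + Vm                     ≡⟨ a+Vm≡n+Vn ⟩
      n + Vn                     ≡⟨ cong₂ _+_ (m∸n+n≡m C≤n) e+Vc≡Vn ⟨
      (j + C) + (e + Vc)         ≡⟨ cong (λ z → (j + C) + (e + z)) f+Pc≡Vc ⟨
      (j + C) + (e + (f + Pc))   ≡⟨ solve 5 (λ j C e f P → (j :+ C) :+ (e :+ (f :+ P)) := (e :+ f :+ j) :+ (C :+ P)) refl j C e f Pc ⟩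
      (e + f + j) + (C + Pc)     ∎)
    where
    open ≡-Reasoning
    c = map (_/ p) m
    C = sum c
    j = n ∸ C
    Vn = proj₁ (isValuation-exists (n !) {{n !≢0}})
    νn! = proj₂ (isValuation-exists (n !) {{n !≢0}})
    Vm = proj₁ (isValuation-exists (sum m !) {{sum m !≢0}})
    νm! = proj₂ (isValuation-exists (sum m !) {{sum m !≢0}})
    Vc = proj₁ (isValuation-exists (C !) {{C !≢0}})
    νC! = proj₂ (isValuation-exists (C !) {{C !≢0}})
    Pc = proj₁ (isValuation-prodFact m)
    sum[m]≡p*n+d∸i : sum m ≡ p * n + d ∸ i
    sum[m]≡p*n+d∸i = trans (sym (m+n∸n≡m (sum m) i)) (cong (_∸ i) sum+i≡p*n+d)
    C≡n∸j : C ≡ n ∸ j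
    C≡n∸j = sym (m∸[m∸n]≡n C≤n)
    a+Vm≡n+Vn : a + Vm ≡ n + Vn
    a+Vm≡n+Vn = isValuation-factRatio (p * n + d) (p * n + d ∸ i) {a} {Vm} {n + Vn} (m∸n≤m (p * n + d) i) νa
      (subst (λ z → IsValuation p (z !) Vm) sum[m]≡p*n+d∸i νm!)
      (isValuation-[p*q+r]! n d d<p νn!)
    b+[C+Pc]≡Vm : b + (C + Pc) ≡ Vm
    b+[C+Pc]≡Vm = isValuation-multinomial m {b} {C + Pc} {Vm} νb (proj₂ (proj₂ (isValuation-prodFact m))) νm!
    e+Vc≡Vn : e + Vc ≡ Vn
    e+Vc≡Vn = isValuation-factRatio n (n ∸ j) {e} {Vc} {Vn} (m∸n≤m n j) νe
      (subst (λ z → IsValuation p (z !) Vc) C≡n∸j νC!) νn!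
    f+Pc≡Vc : f + Pc ≡ Vc
    f+Pc≡Vc = isValuation-multinomial c {f} {Pc} {Vc} νf (proj₁ (proj₂ (isValuation-prodFact m))) νC!

lemma4 : (p k n d i : ℕ) → Prime p → .{{_ : NonZero p}} → 1 ≤ k → d < p → i < k →
    (m : Vec ℕ k) → sum m + i ≡ p * n + d →
    let c = map (λ x → x / p) m
        r = map (λ x → x % p) m
        j = n ∸ sum c
    in (sum c ≤ n) × (j < k) × (sum r + i ≡ p * j + d) ×
       ((a b e f : ℕ) →
         IsValuation p (factRatio (p * n + d) (p * n + d ∸ i)) a →
         IsValuation p (multinomial m) b →
         IsValuation p (factRatio n (n ∸ j)) e →
         IsValuation p (multinomial c) f →
         a + b ≡ e + f + j)
lemma4 p k n d i pr _ d<p i<k m sum+i≡p*n+d =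
  C≤n , j<k , R+i≡p*j+d , valuation-balance n d i m d<p sum+i≡p*n+d C≤n
  where
  open Digits p
  open Valuation pr
  C = sum (map (_/ p) m)
  R = sum (map (_% p) m)
  j = n ∸ C
  R+p*C+i≡p*n+d : R + p * C + i ≡ p * n + d
  R+p*C+i≡p*n+d = trans (cong (_+ i) (sym (sum≡sum[%p]+p*sum[/p] m))) sum+i≡p*n+d
  C≤n : C ≤ n
  C≤n = p*m≤p*n+d⇒m≤n d<p (≤-trans (≤-trans (m≤n+m (p * C) R) (m≤m+n _ i)) (≤-reflexive R+p*C+i≡p*n+d))
  R+i≡p*j+d : R + i ≡ p * j + d
  R+i≡p*j+d = R+p*C+i≡p*n+d⇒R+i≡p*[n∸C]+d {R} {C} {i} C≤n R+p*C+i≡p*n+d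
  j<k : j < k
  j<k = *-cancelˡ-< p j k (begin-strict
    p * j      ≤⟨ m≤m+n (p * j) d ⟩
    p * j + d  ≡⟨ R+i≡p*j+d ⟨
    R + i      <⟨ +-monoʳ-< R i<k ⟩
    R + k      ≤⟨ sum[%p]+k≤k*p m ⟩
    k * p      ≡⟨ *-comm k p ⟩
    p * k      ∎)
    where open ≤-Reasoning
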